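{- Every connected simple graph $G$ with maximum degree at most $6$ has a lattice drawing in $\mathbb{Z}^3$. Moreover, if $G$ is bipartite, it has a lattice drawing in which, for each edge $uv$, the cubes $f(u)$ and $f(v)$ have opposite parity.
   Context: Elements of $\mathbb{Z}^3$ are called cubes; two cubes are adjacent if they differ by $1$ in exactly one coordinate. A wire between cubes $u,v$ is a sequence of distinct cubes $u=c_1,\dots,c_t=v$ such that $c_i,c_j$ are adjacent iff $|i-j|=1$; $c_1,c_t$ are its endpoints and $c_2,\dots,c_{t-1}$ its interior. A collection of wires is proper if no wire meets the interior of another wire, and two cubes in the union of the wires are adjacent iff they are consecutive elements in (precisely) one wire. A lattice drawing of a graph $G$ consists of an injective map $f:V(G)\to\mathbb{Z}^3$ and, for each edge $uv$, a wire connecting $f(u)$ and $f(v)$, such that the collection of these wires is proper. The parity of $(x,y,z)\in\mathbb{Z}^3$ is $x+y+z \bmod 2$. -}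

module Defs where

open import Data.Nat using (ℕ; zero; suc; _≤_; _<_)
open import Data.Integer as ℤ using (ℤ; ∣_∣; _-_; _%ℕ_)
open import Data.Fin using (Fin; toℕ; fromℕ) renaming (zero to fzero)
open import Data.Bool using (Bool; true; false; if_then_else_)
open import Data.List using (List; map; allFin)
open import Data.Nat.ListAction using (sum)
open import Data.Product using (Σ; ∃; ∃-syntax; _×_; _,_; proj₁; proj₂)
open import Data.Sum using (_⊎_)
open import Relation.Nullary using (¬_)
open import Relation.Binary.PropositionalEquality using (_≡_; _≢_)
open import Function.Definitions using (Injective)
open import Function.Bundles using (_⇔_)

Cube : Set
Cube = ℤ × ℤ × ℤ

Adjacent : Cube → Cube → Set
Adjacent (x , y , z) (x' , y' , z') =
  (∣ x - x' ∣ ≡ 1 × y ≡ y' × z ≡ z')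
  ⊎ (x ≡ x' × ∣ y - y' ∣ ≡ 1 × z ≡ z')
  ⊎ (x ≡ x' × y ≡ y' × ∣ z - z' ∣ ≡ 1)

parity : Cube → ℕ
parity (x , y , z) = (x ℤ.+ y ℤ.+ z) %ℕ 2

-- Wires.  A wire c_1,...,c_t is stored with t = suc len, as
-- cube : Fin (suc len) → Cube  (cube i = c_{i+1}).

record Wire : Set where
  field
    len      : ℕ
    cube     : Fin (suc len) → Cube
    distinct : Injective _≡_ _≡_ cube
    induced  : ∀ i j → Adjacent (cube i) (cube j)
                 ⇔ (toℕ i ≡ suc (toℕ j) ⊎ toℕ j ≡ suc (toℕ i))

open Wire public

WireBetween : Wire → Cube → Cube → Set
WireBetween w a b = cube w fzero ≡ a × cube w (fromℕ (len w)) ≡ b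

OnWire : Wire → Cube → Set
OnWire w x = ∃[ i ] cube w i ≡ x

InInterior : Wire → Cube → Set
InInterior w x = ∃[ i ] (0 < toℕ i × toℕ i < len w × cube w i ≡ x)

Consecutive : Wire → Cube → Cube → Set
Consecutive w a b = ∃[ i ] ∃[ j ] (toℕ j ≡ suc (toℕ i) ×
  ((cube w i ≡ a × cube w j ≡ b) ⊎ (cube w i ≡ b × cube w j ≡ a)))

record Proper (I : Set) (_≈_ : I → I → Set) (W : I → Wire) : Set where
  field
    noInteriorMeet : ∀ e e' → ¬ (e ≈ e') → ∀ x →
                       OnWire (W e') x → ¬ InInterior (W e) x
    adjacency : ∀ a b → (∃[ e ] OnWire (W e) a) → (∃[ e ] OnWire (W e) b) →
                  Adjacent a b ⇔
                  (∃[ e ] (Consecutive (W e) a b ×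
                     (∀ e' → Consecutive (W e') a b → e' ≈ e)))

record Graph (n : ℕ) : Set where
  field
    E     : Fin n → Fin n → Bool
    sym   : ∀ u v → E u v ≡ E v u
    irrefl : ∀ v → E v v ≡ false

open Graph public

degree : ∀ {n} → Graph n → Fin n → ℕ
degree G v = sum (map (λ u → if E G v u then 1 else 0) (allFin _))

MaxDegreeAtMost : ∀ {n} → Graph n → ℕ → Set
MaxDegreeAtMost G k = ∀ v → degree G v ≤ k

data Reach {n} (G : Graph n) : Fin n → Fin n → Set where
  here : ∀ {v} → Reach G v v
  step : ∀ {u w v} → E G u w ≡ true → Reach G w v → Reach G u v

Connected : ∀ {n} → Graph n → Set
Connected G = ∀ u v → Reach G u v

Bipartite : ∀ {n} → Graph n → Set
Bipartite {n} G = Σ (Fin n → Bool) λ col → (∀ u v → E G u v ≡ true → col u ≢ col v)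

-- Edges: unordered pairs {u,v}, represented with toℕ u < toℕ v
Edge : ∀ {n} → Graph n → Set
Edge {n} G = Σ (Fin n × Fin n) λ { (u , v) → toℕ u < toℕ v × E G u v ≡ true }

SameEdge : ∀ {n} {G : Graph n} → Edge G → Edge G → Set
SameEdge ((u , v) , _) ((u' , v') , _) = u ≡ u' × v ≡ v'

endpoints : ∀ {n} {G : Graph n} → Edge G → Fin n × Fin n
endpoints (uv , _) = uv

record LatticeDrawing {n} (G : Graph n) : Set where
  field
    f       : Fin n → Cube
    f-inj   : Injective _≡_ _≡_ f
    wire    : Edge G → Wire
    between : ∀ (e : Edge G) →
                WireBetween (wire e) (f (proj₁ (endpoints {G = G} e)))
                                     (f (proj₂ (endpoints {G = G} e)))
    proper  : Proper (Edge G) (SameEdge {G = G}) wire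

open LatticeDrawing public

OppositeParity : ∀ {n} {G : Graph n} → LatticeDrawing G → Set
OppositeParity {G = G} D =
  ∀ u v → E G u v ≡ true → parity (f D u) ≢ parity (f D v)

-- Vertex w gets its own block of x-coordinates [B, B + 10], B = 16 w + c(w) for a 2-colouring c
-- (or c = 0), and is drawn at (B + 4, 2, 2).  Ranking the at most six neighbours of w gives every
-- incident edge a port, and a fixed gadget of six pairwise far stubs in the slab z ≤ 2 of the block
-- leads from the vertex to six sockets.  The wire of an edge uv climbs from u's socket to the height
-- 4 + t, with t twice the index of the pair (u, v), moves in y to y = 6 beyond all gadgets, crosses in x
-- to v's block and descends symmetrically.  Distinct edges then run at heights two apart, distinct
-- vertices live in blocks two apart, and distinct ports of one vertex are apart by a finite check, so
-- every wire is an induced path and two wires meet only in common end vertices.  The vertex point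
-- has parity c(w).

module Submission where

open import Defs hiding (sym)
open import Data.Nat
  using (ℕ; zero; suc; _+_; _*_; _∸_; _%_; _≤_; _<_; z≤n; s≤s; z<s; s<s; ∣_-_∣)
open import Data.Nat.Properties
open import Data.Nat.DivMod using ([m+kn]%n≡m%n; m<n⇒m%n≡m)
open import Data.Nat.ListAction using (sum)
open import Data.Nat.Tactic.RingSolver using (solve-∀)
open import Data.Integer as ℤ using (+_)
import Data.Integer.Properties as ℤ
open import Data.Bool using (Bool; true; false; _∧_; if_then_else_)
import Data.Bool.Properties as Bool
open import Data.Fin as Fin using (Fin; toℕ; fromℕ) renaming (zero to fzero; suc to fsuc)
import Data.Fin.Properties as Fin
open import Data.List
  using (List; []; _∷_; _++_; _∷ʳ_; [_]; length; lookup; reverse; applyUpTo; map; allFin)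
open import Data.List.Properties using (unfold-reverse; reverse-++; ++-assoc; applyUpTo-∷ʳ)
open import Data.List.Relation.Unary.All as All using (All; []; _∷_)
import Data.List.Relation.Unary.All.Properties as All
open import Data.List.Relation.Unary.Any as Any using (here; there)
import Data.List.Relation.Unary.Any.Properties as Any
open import Data.List.Membership.Propositional using (_∈_; _∉_)
open import Data.List.Membership.Propositional.Properties
  using (∈-lookup; ∈-++⁺ʳ; ∈-++⁻; ∈-allFin)
open import Data.Product using (Σ; ∃; ∃-syntax; _×_; _,_; proj₁; proj₂; uncurry)
open import Data.Sum using (_⊎_; inj₁; inj₂)
open import Data.Empty using (⊥; ⊥-elim)
open import Data.Unit using (⊤; tt)
open import Function.Base using (_∘_)
open import Function.Bundles using (_⇔_; mk⇔; Equivalence)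
open import Function.Definitions using (Injective)
open import Function.Properties.Equivalence using () renaming (trans to ⇔-trans)
open import Relation.Nullary using (¬_; Dec; does; yes; no; contradiction)
open import Relation.Nullary.Decidable
  using (map′; _×-dec_; _⊎-dec_; toWitness; dec-true; dec-false)
open import Relation.Binary.Definitions using (DecidableEquality; tri<; tri≈; tri>)
open import Relation.Binary.PropositionalEquality hiding ([_])
open import Axiom.UniquenessOfIdentityProofs using (module Decidable⇒UIP)

∣+m-+n∣≡∣m-n∣ : ∀ m n → ℤ.∣ + m ℤ.- + n ∣ ≡ ∣ m - n ∣
∣+m-+n∣≡∣m-n∣ m n rewrite ℤ.m-n≡m⊖n m n with ≤-total m n
... | inj₁ m≤n = trans (ℤ.∣⊖∣-≤ m≤n) (sym (m≤n⇒∣m-n∣≡n∸m m≤n))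
... | inj₂ n≤m =
  trans (ℤ.∣m⊖n∣≡∣n⊖m∣ m n) (trans (ℤ.∣⊖∣-≤ n≤m) (sym (m≤n⇒∣n-m∣≡n∸m n≤m)))

m+n≤o⇒n≤∣m-o∣ : ∀ m n o → m + n ≤ o → n ≤ ∣ m - o ∣
m+n≤o⇒n≤∣m-o∣ zero n o le = le
m+n≤o⇒n≤∣m-o∣ (suc m) n (suc o) (s≤s le) = m+n≤o⇒n≤∣m-o∣ m n o le

∣n-1+n∣≡1 : ∀ n → ∣ n - suc n ∣ ≡ 1
∣n-1+n∣≡1 zero = refl
∣n-1+n∣≡1 (suc n) = ∣n-1+n∣≡1 n

m+1≤1+n+m : ∀ m n → m + 1 ≤ suc n + m
m+1≤1+n+m m n = subst (_≤ suc n + m) (+-comm 1 m) (+-monoˡ-≤ m (s≤s z≤n))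

∣i+n-j+n∣≡∣i-j∣ : ∀ n i j → ∣ i + n - (j + n) ∣ ≡ ∣ i - j ∣
∣i+n-j+n∣≡∣i-j∣ n i j rewrite +-comm i n | +-comm j n = ∣m+n-m+o∣≡∣n-o∣ n i j

Point : Set
Point = ℕ × ℕ × ℕ

xc yc zc : Point → ℕ
xc (x , _ , _) = x
yc (_ , y , _) = y
zc (_ , _ , z) = z

toCube : Point → Cube
toCube (x , y , z) = (+ x , + y , + z)

toCube-injective : Injective _≡_ _≡_ toCube
toCube-injective {x , y , z} {x′ , y′ , z′} eq
  rewrite ℤ.+-injective (cong proj₁ eq)
        | ℤ.+-injective (cong (proj₁ ∘ proj₂) eq)
        | ℤ.+-injective (cong (proj₂ ∘ proj₂) eq) = refl

dist : Point → Point → ℕ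
dist (x , y , z) (x′ , y′ , z′) = ∣ x - x′ ∣ + ∣ y - y′ ∣ + ∣ z - z′ ∣

dist-comm : ∀ a b → dist a b ≡ dist b a
dist-comm (x , y , z) (x′ , y′ , z′)
  rewrite ∣-∣-comm x x′ | ∣-∣-comm y y′ | ∣-∣-comm z z′ = refl

dist-self : ∀ a → dist a a ≡ 0
dist-self (x , y , z) rewrite ∣n-n∣≡0 x | ∣n-n∣≡0 y | ∣n-n∣≡0 z = refl

dist-step-y : ∀ x y z → dist (x , y , z) (x , suc y , z) ≡ 1
dist-step-y x y z rewrite ∣n-n∣≡0 x | ∣n-1+n∣≡1 y | ∣n-n∣≡0 z = refl

dist-step-z : ∀ x y z → dist (x , y , z) (x , y , suc z) ≡ 1
dist-step-z x y z rewrite ∣n-n∣≡0 x | ∣n-n∣≡0 y | ∣n-1+n∣≡1 z = refl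

private
  sum≡1 : ∀ a b c → a + b + c ≡ 1 →
    (a ≡ 1 × b ≡ 0 × c ≡ 0) ⊎ (a ≡ 0 × b ≡ 1 × c ≡ 0) ⊎ (a ≡ 0 × b ≡ 0 × c ≡ 1)
  sum≡1 0 0 c eq = inj₂ (inj₂ (refl , refl , eq))
  sum≡1 0 1 0 refl = inj₂ (inj₁ (refl , refl , refl))
  sum≡1 1 0 0 refl = inj₁ (refl , refl , refl)
  sum≡1 0 1 (suc _) ()
  sum≡1 0 (suc (suc _)) _ ()
  sum≡1 1 0 (suc _) ()
  sum≡1 1 (suc _) _ ()
  sum≡1 (suc (suc _)) _ _ ()

  +≡+⇒∣-∣≡0 : ∀ {m n} → + m ≡ + n → ∣ m - n ∣ ≡ 0
  +≡+⇒∣-∣≡0 eq = m≡n⇒∣m-n∣≡0 (ℤ.+-injective eq)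

  ∣-∣≡0⇒+≡+ : ∀ {m n} → ∣ m - n ∣ ≡ 0 → + m ≡ + n
  ∣-∣≡0⇒+≡+ eq = cong +_ (∣m-n∣≡0⇒m≡n eq)

adjacent⇔dist≡1 : ∀ a b → Adjacent (toCube a) (toCube b) ⇔ dist a b ≡ 1
adjacent⇔dist≡1 (x , y , z) (x′ , y′ , z′) = mk⇔ to from
  where
  to : Adjacent (toCube (x , y , z)) (toCube (x′ , y′ , z′)) →
    dist (x , y , z) (x′ , y′ , z′) ≡ 1
  to (inj₁ (p , q , r))
    rewrite sym (∣+m-+n∣≡∣m-n∣ x x′) | p | +≡+⇒∣-∣≡0 q | +≡+⇒∣-∣≡0 r = refl
  to (inj₂ (inj₁ (p , q , r)))
    rewrite +≡+⇒∣-∣≡0 p | sym (∣+m-+n∣≡∣m-n∣ y y′) | q | +≡+⇒∣-∣≡0 r = refl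
  to (inj₂ (inj₂ (p , q , r)))
    rewrite +≡+⇒∣-∣≡0 p | +≡+⇒∣-∣≡0 q | sym (∣+m-+n∣≡∣m-n∣ z z′) | r = refl
  from : dist (x , y , z) (x′ , y′ , z′) ≡ 1 →
    Adjacent (toCube (x , y , z)) (toCube (x′ , y′ , z′))
  from eq with sum≡1 ∣ x - x′ ∣ ∣ y - y′ ∣ ∣ z - z′ ∣ eq
  ... | inj₁ (p , q , r) =
    inj₁ (trans (∣+m-+n∣≡∣m-n∣ x x′) p , ∣-∣≡0⇒+≡+ q , ∣-∣≡0⇒+≡+ r)
  ... | inj₂ (inj₁ (p , q , r)) =
    inj₂ (inj₁ (∣-∣≡0⇒+≡+ p , trans (∣+m-+n∣≡∣m-n∣ y y′) q , ∣-∣≡0⇒+≡+ r))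
  ... | inj₂ (inj₂ (p , q , r)) =
    inj₂ (inj₂ (∣-∣≡0⇒+≡+ p , ∣-∣≡0⇒+≡+ q , trans (∣+m-+n∣≡∣m-n∣ z z′) r))

record Far (a b : Point) : Set where
  constructor far
  field 2≤dist : 2 ≤ dist a b

Far-sym : ∀ {a b} → Far a b → Far b a
Far-sym {a} {b} (far le) = far (subst (2 ≤_) (dist-comm a b) le)

Far⇒dist≢1 : ∀ {a b} → Far a b → dist a b ≢ 1
Far⇒dist≢1 (far le) eq with subst (2 ≤_) eq le
... | s≤s ()

Far-irrefl : ∀ {a} → Far a a → ⊥
Far-irrefl {a} (far le) with subst (2 ≤_) (dist-self a) le
... | ()

Far-x : ∀ {a b} → 2 ≤ ∣ xc a - xc b ∣ → Far a b
Far-x {x , y , z} {x′ , y′ , z′} le =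
  far (≤-trans le (≤-trans (m≤m+n ∣ x - x′ ∣ ∣ y - y′ ∣) (m≤m+n _ ∣ z - z′ ∣)))

Far-y : ∀ {a b} → 2 ≤ ∣ yc a - yc b ∣ → Far a b
Far-y {x , y , z} {x′ , y′ , z′} le =
  far (≤-trans le (≤-trans (m≤n+m ∣ y - y′ ∣ ∣ x - x′ ∣) (m≤m+n _ ∣ z - z′ ∣)))

Far-z : ∀ {a b} → 2 ≤ ∣ zc a - zc b ∣ → Far a b
Far-z {x , y , z} {x′ , y′ , z′} le =
  far (≤-trans le (m≤n+m ∣ z - z′ ∣ (∣ x - x′ ∣ + ∣ y - y′ ∣)))

Far-xy : ∀ {a b} → 1 ≤ ∣ xc a - xc b ∣ → 1 ≤ ∣ yc a - yc b ∣ → Far a b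
Far-xy {x , y , z} {x′ , y′ , z′} p q =
  far (≤-trans (+-mono-≤ p q) (m≤m+n (∣ x - x′ ∣ + ∣ y - y′ ∣) ∣ z - z′ ∣))

Far-yz : ∀ {a b} → 1 ≤ ∣ yc a - yc b ∣ → 1 ≤ ∣ zc a - zc b ∣ → Far a b
Far-yz {x , y , z} {x′ , y′ , z′} p q =
  far (≤-trans (+-mono-≤ p q) (+-monoˡ-≤ ∣ z - z′ ∣ (m≤n+m ∣ y - y′ ∣ ∣ x - x′ ∣)))

Far-x< : ∀ {a b} → xc a + 2 ≤ xc b → Far a b
Far-x< {a} {b} le = Far-x {a} {b} (m+n≤o⇒n≤∣m-o∣ (xc a) 2 (xc b) le)

Far-y< : ∀ {a b} → yc a + 2 ≤ yc b → Far a b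
Far-y< {a} {b} le = Far-y {a} {b} (m+n≤o⇒n≤∣m-o∣ (yc a) 2 (yc b) le)

Far-z< : ∀ {a b} → zc a + 2 ≤ zc b → Far a b
Far-z< {a} {b} le = Far-z {a} {b} (m+n≤o⇒n≤∣m-o∣ (zc a) 2 (zc b) le)

Induced : List Point → Set
Induced [] = ⊤
Induced (_ ∷ []) = ⊤
Induced (a ∷ b ∷ cs) = dist a b ≡ 1 × All (Far a) cs × Induced (b ∷ cs)

induced-lookup : ∀ {L} → Induced L → ∀ i j → toℕ i < toℕ j →
  (toℕ j ≡ suc (toℕ i) × dist (lookup L i) (lookup L j) ≡ 1)
  ⊎ (suc (toℕ i) < toℕ j × Far (lookup L i) (lookup L j))
induced-lookup {_ ∷ _ ∷ _} (d≡1 , _ , _) fzero (fsuc fzero) _ = inj₁ (refl , d≡1)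
induced-lookup {_ ∷ _ ∷ _} (_ , fars , _) fzero (fsuc (fsuc j)) _ =
  inj₂ (s≤s (s≤s z≤n) , All.lookup fars (∈-lookup j))
induced-lookup {_ ∷ _ ∷ _} (_ , _ , ind) (fsuc i) (fsuc j) (s≤s i<j)
  with induced-lookup ind i j i<j
... | inj₁ (eq , d≡1) = inj₁ (cong suc eq , d≡1)
... | inj₂ (lt , f) = inj₂ (s≤s lt , f)

induced-head-distinct : ∀ {a} L → Induced (a ∷ L) → All (_≢ a) L
induced-head-distinct [] _ = []
induced-head-distinct {a} (b ∷ L) (d≡1 , fars , _) =
  b≢a ∷ All.map (λ f eq → Far-irrefl (subst (Far a) eq f)) fars
  where
  b≢a : b ≢ a
  b≢a refl = 0≢1+n (trans (sym (dist-self a)) d≡1)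

module _ {L : List Point} (ind : Induced L) where

  lookup-distinct : ∀ i j → toℕ i < toℕ j → lookup L i ≢ lookup L j
  lookup-distinct i j i<j eq with induced-lookup ind i j i<j
  ... | inj₁ (_ , d≡1) =
    0≢1+n (trans (sym (dist-self (lookup L j))) (subst (λ a → dist a (lookup L j) ≡ 1) eq d≡1))
  ... | inj₂ (_ , f) = Far-irrefl (subst (λ a → Far a (lookup L j)) eq f)

  lookup-injective : Injective _≡_ _≡_ (lookup L)
  lookup-injective {i} {j} eq with <-cmp (toℕ i) (toℕ j)
  ... | tri< i<j _ _ = ⊥-elim (lookup-distinct i j i<j eq)
  ... | tri≈ _ i≡j _ = Fin.toℕ-injective i≡j
  ... | tri> _ _ j<i = ⊥-elim (lookup-distinct j i j<i (sym eq))

  private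
    dist≡1⇒consecutive : ∀ i j → toℕ i < toℕ j → dist (lookup L i) (lookup L j) ≡ 1 →
      toℕ j ≡ suc (toℕ i)
    dist≡1⇒consecutive i j i<j d≡1 with induced-lookup ind i j i<j
    ... | inj₁ (j≡1+i , _) = j≡1+i
    ... | inj₂ (_ , f) = ⊥-elim (Far⇒dist≢1 f d≡1)

    consecutive⇒dist≡1 : ∀ i j → toℕ j ≡ suc (toℕ i) → dist (lookup L i) (lookup L j) ≡ 1
    consecutive⇒dist≡1 i j j≡1+i with induced-lookup ind i j (≤-reflexive (sym j≡1+i))
    ... | inj₁ (_ , d≡1) = d≡1
    ... | inj₂ (1+i<j , _) = ⊥-elim (<-irrefl (sym j≡1+i) 1+i<j)

  dist-lookup≡1⇔consecutive : ∀ i j →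
    dist (lookup L i) (lookup L j) ≡ 1 ⇔ (toℕ i ≡ suc (toℕ j) ⊎ toℕ j ≡ suc (toℕ i))
  dist-lookup≡1⇔consecutive i j = mk⇔ to from
    where
    to : dist (lookup L i) (lookup L j) ≡ 1 → toℕ i ≡ suc (toℕ j) ⊎ toℕ j ≡ suc (toℕ i)
    to d≡1 with <-cmp (toℕ i) (toℕ j)
    ... | tri< i<j _ _ = inj₂ (dist≡1⇒consecutive i j i<j d≡1)
    ... | tri> _ _ j<i =
      inj₁ (dist≡1⇒consecutive j i j<i (trans (dist-comm (lookup L j) (lookup L i)) d≡1))
    ... | tri≈ _ i≡j _ rewrite Fin.toℕ-injective {i = i} {j = j} i≡j =
      ⊥-elim (0≢1+n (trans (sym (dist-self (lookup L j))) d≡1))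
    from : toℕ i ≡ suc (toℕ j) ⊎ toℕ j ≡ suc (toℕ i) → dist (lookup L i) (lookup L j) ≡ 1
    from (inj₁ i≡1+j) = trans (dist-comm (lookup L i) (lookup L j)) (consecutive⇒dist≡1 j i i≡1+j)
    from (inj₂ j≡1+i) = consecutive⇒dist≡1 i j j≡1+i

pathWire : (a : Point) (cs : List Point) → Induced (a ∷ cs) → Wire
pathWire a cs ind = record
  { len = length cs
  ; cube = toCube ∘ lookup (a ∷ cs)
  ; distinct = lookup-injective ind ∘ toCube-injective
  ; induced = λ i j → ⇔-trans (adjacent⇔dist≡1 (lookup (a ∷ cs) i) (lookup (a ∷ cs) j))
                                 (dist-lookup≡1⇔consecutive ind i j)
  }

module _ {a : Point} {cs : List Point} (ind : Induced (a ∷ cs)) where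

  onWire⇒∈ : ∀ {x} → OnWire (pathWire a cs ind) x →
    ∃[ y ] (y ∈ a ∷ cs × x ≡ toCube y)
  onWire⇒∈ (i , eq) = lookup (a ∷ cs) i , ∈-lookup i , sym eq

  ∈⇒onWire : ∀ {y} → y ∈ a ∷ cs → OnWire (pathWire a cs ind) (toCube y)
  ∈⇒onWire y∈ = Any.index y∈ , cong toCube (sym (Any.lookup-index y∈))

  onWire-toCube⇒∈ : ∀ {y} → OnWire (pathWire a cs ind) (toCube y) → y ∈ a ∷ cs
  onWire-toCube⇒∈ on with onWire⇒∈ on
  ... | z , z∈ , eq rewrite toCube-injective eq = z∈

module _ {a b : Point} {I : List Point} (ind : Induced (a ∷ I ∷ʳ b)) where

  pathWire-between : WireBetween (pathWire a (I ∷ʳ b) ind) (toCube a) (toCube b)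
  pathWire-between = refl , cong toCube (lookup-last a I)
    where
    lookup-last : ∀ a I → lookup (a ∷ I ∷ʳ b) (fromℕ (length (I ∷ʳ b))) ≡ b
    lookup-last a [] = refl
    lookup-last a (x ∷ I) = lookup-last x I

  interior⇒∈ : ∀ {x} → InInterior (pathWire a (I ∷ʳ b) ind) x →
    ∃[ y ] (y ∈ I × x ≡ toCube y)
  interior⇒∈ (fsuc j , _ , j<len , eq) = lookup (I ∷ʳ b) j , lookup-init I j j<len , sym eq
    where
    lookup-init : ∀ I (j : Fin (length (I ∷ʳ b))) → suc (toℕ j) < length (I ∷ʳ b) →
      lookup (I ∷ʳ b) j ∈ I
    lookup-init [] fzero (s≤s ())
    lookup-init (x ∷ I) fzero _ = here refl
    lookup-init (x ∷ I) (fsuc j) (s≤s lt) = there (lookup-init I j lt)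

consecutive⇒onWire : ∀ w {a b} → Consecutive w a b → OnWire w a × OnWire w b
consecutive⇒onWire w (i , j , _ , inj₁ (p , q)) = (i , p) , (j , q)
consecutive⇒onWire w (i , j , _ , inj₂ (p , q)) = (j , q) , (i , p)

consecutive⇒adjacent : ∀ w {a b} → Consecutive w a b → Adjacent a b
consecutive⇒adjacent w (i , j , j≡1+i , inj₁ (refl , refl)) =
  Equivalence.from (induced w i j) (inj₂ j≡1+i)
consecutive⇒adjacent w (i , j , j≡1+i , inj₂ (refl , refl)) =
  Equivalence.from (induced w j i) (inj₁ j≡1+i)

adjacent⇒consecutive : ∀ w {a b} → OnWire w a → OnWire w b → Adjacent a b → Consecutive w a b
adjacent⇒consecutive w (i , refl) (j , refl) adj with Equivalence.to (induced w i j) adj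
... | inj₁ i≡1+j = j , i , i≡1+j , inj₂ (refl , refl)
... | inj₂ j≡1+i = i , j , j≡1+i , inj₁ (refl , refl)

module Properness {I : Set} (_≈_ : I → I → Set) (≈-refl : ∀ {e} → e ≈ e)
  (_≟_ : DecidableEquality I) (start end : I → Point) (interior : I → List Point)
  (path-induced : ∀ e → Induced (start e ∷ interior e ∷ʳ end e)) where

  path : I → List Point
  path e = start e ∷ interior e ∷ʳ end e

  wireAt : I → Wire
  wireAt e = pathWire (start e) (interior e ∷ʳ end e) (path-induced e)

  UniquelyConsecutive : Cube → Cube → Set
  UniquelyConsecutive a b =
    ∃[ e ] (Consecutive (wireAt e) a b × (∀ e′ → Consecutive (wireAt e′) a b → e′ ≈ e))

  IsEnd : I → Point → Set
  IsEnd e y = y ≡ start e ⊎ y ≡ end e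

  end∈path : ∀ {e y} → IsEnd e y → y ∈ path e
  end∈path (inj₁ refl) = here refl
  end∈path {e} (inj₂ refl) = there (∈-++⁺ʳ (interior e) (here refl))

  ∈path⇒end⊎interior : ∀ {e y} → y ∈ path e → IsEnd e y ⊎ y ∈ interior e
  ∈path⇒end⊎interior (here refl) = inj₁ (inj₁ refl)
  ∈path⇒end⊎interior {e} (there y∈) with ∈-++⁻ (interior e) y∈
  ... | inj₁ y∈I = inj₂ y∈I
  ... | inj₂ (here refl) = inj₁ (inj₂ refl)

  module _
    (ends-not-adjacent : ∀ e e′ {a b} → IsEnd e a → IsEnd e′ b → dist a b ≢ 1)
    (separated : ∀ {e e′} → e ≢ e′ → ∀ {x y} → x ∈ interior e → y ∈ path e′ →
                   Far x y ⊎ (IsEnd e y × x ≢ y))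
    where

    interior∉path : ∀ {e e′} → e ≢ e′ → ∀ {x} → x ∈ interior e → x ∉ path e′
    interior∉path e≢e′ x∈ x∈′ with separated e≢e′ x∈ x∈′
    ... | inj₁ f = Far-irrefl f
    ... | inj₂ (_ , x≢x) = x≢x refl

    adjacent-on-one-path : ∀ {e e′} → e ≢ e′ → ∀ {a b} → a ∈ path e → b ∈ path e →
      a ∈ path e′ → b ∈ path e′ → dist a b ≢ 1
    adjacent-on-one-path {e} e≢e′ a∈ b∈ a∈′ b∈′
      with ∈path⇒end⊎interior a∈ | ∈path⇒end⊎interior b∈
    ... | inj₂ a∈I | _ = ⊥-elim (interior∉path e≢e′ a∈I a∈′)
    ... | inj₁ _ | inj₂ b∈I = ⊥-elim (interior∉path e≢e′ b∈I b∈′)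
    ... | inj₁ a-end | inj₁ b-end = ends-not-adjacent e e a-end b-end

    adjacent⇒common-path : ∀ {e₁ e₂ a b} → a ∈ path e₁ → b ∈ path e₂ → dist a b ≡ 1 →
      ∃[ e ] (a ∈ path e × b ∈ path e)
    adjacent⇒common-path {e₁} {e₂} a∈ b∈ d≡1 with e₁ ≟ e₂
    ... | yes refl = e₁ , a∈ , b∈
    ... | no e₁≢e₂ with ∈path⇒end⊎interior a∈ | ∈path⇒end⊎interior b∈
    ...   | inj₂ a∈I | _ with separated e₁≢e₂ a∈I b∈
    ...     | inj₁ f = ⊥-elim (Far⇒dist≢1 f d≡1)
    ...     | inj₂ (b-end , _) = e₁ , a∈ , end∈path b-end
    adjacent⇒common-path {e₂ = e₂} {a} {b} a∈ b∈ d≡1 | no e₁≢e₂ | inj₁ a-end | inj₂ b∈I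
      with separated (e₁≢e₂ ∘ sym) b∈I a∈
    ... | inj₁ f = ⊥-elim (Far⇒dist≢1 f (trans (dist-comm b a) d≡1))
    ... | inj₂ (a-end′ , _) = e₂ , end∈path a-end′ , b∈
    adjacent⇒common-path {e₁} {e₂} a∈ b∈ d≡1 | no _ | inj₁ a-end | inj₁ b-end =
      ⊥-elim (ends-not-adjacent e₁ e₂ a-end b-end d≡1)

    private
      onWire⇒∈path : ∀ {e x} → OnWire (wireAt e) x → ∃[ y ] (y ∈ path e × x ≡ toCube y)
      onWire⇒∈path {e} = onWire⇒∈ (path-induced e)

      consecutive-unique : ∀ {e a b} → a ∈ path e → b ∈ path e → dist a b ≡ 1 →
        ∀ e′ → Consecutive (wireAt e′) (toCube a) (toCube b) → e′ ≈ e
      consecutive-unique {e} a∈ b∈ d≡1 e′ cons with e′ ≟ e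
      ... | yes refl = ≈-refl
      ... | no e′≢e =
        ⊥-elim (adjacent-on-one-path (e′≢e ∘ sym) a∈ b∈
          (onWire-toCube⇒∈ (path-induced e′) (proj₁ (consecutive⇒onWire (wireAt e′) cons)))
          (onWire-toCube⇒∈ (path-induced e′) (proj₂ (consecutive⇒onWire (wireAt e′) cons))) d≡1)

      adjacency-points : ∀ {e₁ e₂ a b} → a ∈ path e₁ → b ∈ path e₂ →
        Adjacent (toCube a) (toCube b) ⇔ UniquelyConsecutive (toCube a) (toCube b)
      adjacency-points {a = a} {b} a∈ b∈ =
        mk⇔ to (λ (e , cons , _) → consecutive⇒adjacent (wireAt e) cons)
        where
        to : Adjacent (toCube a) (toCube b) → UniquelyConsecutive (toCube a) (toCube b)
        to adj with adjacent⇒common-path a∈ b∈ (Equivalence.to (adjacent⇔dist≡1 a b) adj)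
        ... | e , a∈′ , b∈′ =
          e , adjacent⇒consecutive (wireAt e) (∈⇒onWire (path-induced e) a∈′)
                                             (∈⇒onWire (path-induced e) b∈′) adj
            , consecutive-unique a∈′ b∈′ (Equivalence.to (adjacent⇔dist≡1 a b) adj)

    wires-proper : Proper I _≈_ wireAt
    wires-proper = record
      { noInteriorMeet = λ e e′ e≉e′ x on int →
          no-meet e e′ (e≉e′ ∘ ≡⇒≈) (onWire⇒∈path on) (interior⇒∈ (path-induced e) int)
      ; adjacency = λ a b (_ , on-a) (_ , on-b) →
          adjacency-cubes (onWire⇒∈path on-a) (onWire⇒∈path on-b)
      }
      where
      ≡⇒≈ : ∀ {e e′} → e ≡ e′ → e ≈ e′
      ≡⇒≈ refl = ≈-refl
      no-meet : ∀ e e′ → e ≢ e′ → ∀ {x} → ∃[ y ] (y ∈ path e′ × x ≡ toCube y) →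
        ¬ (∃[ y ] (y ∈ interior e × x ≡ toCube y))
      no-meet e e′ e≢e′ (y , y∈ , refl) (z , z∈ , eq) rewrite toCube-injective eq =
        interior∉path e≢e′ z∈ y∈
      adjacency-cubes : ∀ {e₁ e₂ a b} → ∃[ y ] (y ∈ path e₁ × a ≡ toCube y) →
        ∃[ y ] (y ∈ path e₂ × b ≡ toCube y) →
        Adjacent a b ⇔ UniquelyConsecutive a b
      adjacency-cubes (_ , a∈ , refl) (_ , b∈ , refl) = adjacency-points a∈ b∈

Joinable : List Point → List Point → Set
Joinable [] _ = ⊤
Joinable (_ ∷ []) [] = ⊤
Joinable (a ∷ []) (b ∷ bs) = dist a b ≡ 1 × All (Far a) bs
Joinable (a ∷ a′ ∷ as) B = All (Far a) B × Joinable (a′ ∷ as) B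

AllFar : List Point → List Point → Set
AllFar A B = All (λ a → All (Far a) B) A

AllFar-by : ∀ {P Q : Point → Set} {A B} → All P A → All Q B →
  (∀ {a b} → P a → Q b → Far a b) → AllFar A B
AllFar-by pa qb far-pq = All.map (λ p → All.map (far-pq p) qb) pa

induced-++ : ∀ A {B} → Induced A → Induced B → Joinable A B → Induced (A ++ B)
induced-++ [] _ indB _ = indB
induced-++ (a ∷ []) {[]} _ _ _ = tt
induced-++ (a ∷ []) {b ∷ bs} _ indB (d≡1 , fars) = d≡1 , fars , indB
induced-++ (a ∷ a′ ∷ as) (d≡1 , fars , indA) indB (farsB , join) =
  d≡1 , All.++⁺ fars farsB , induced-++ (a′ ∷ as) indA indB join

joinable-++ʳ : ∀ A {b bs C} → Joinable A (b ∷ bs) → AllFar A C → Joinable A (b ∷ bs ++ C)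
joinable-++ʳ [] _ _ = tt
joinable-++ʳ (a ∷ []) (d≡1 , fars) (farsC ∷ []) = d≡1 , All.++⁺ fars farsC
joinable-++ʳ (a ∷ a′ ∷ as) (fars , join) (farsC ∷ farss) =
  All.++⁺ fars farsC , joinable-++ʳ (a′ ∷ as) join farss

joinable-++ˡ : ∀ A {b bs C} → AllFar A C → Joinable (b ∷ bs) C → Joinable (A ++ b ∷ bs) C
joinable-++ˡ [] _ join = join
joinable-++ˡ (a ∷ []) (fars ∷ []) join = fars , join
joinable-++ˡ (a ∷ a′ ∷ as) (fars ∷ farss) join = fars , joinable-++ˡ (a′ ∷ as) farss join

All-reverse : ∀ {P : Point → Set} {xs} → All P xs → All P (reverse xs)
All-reverse ps = All.tabulate (All.lookup ps ∘ Any.reverse⁻)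

AllFar-sym : ∀ {A B} → AllFar A B → AllFar B A
AllFar-sym fars = All.tabulate λ b∈ → All.map (λ fs → Far-sym (All.lookup fs b∈)) fars

AllFar-++ʳ : ∀ {A B C} → AllFar A B → AllFar A C → AllFar A (B ++ C)
AllFar-++ʳ farsB farsC = All.zipWith (uncurry All.++⁺) (farsB , farsC)

AllFar-reverseʳ : ∀ {A B} → AllFar A B → AllFar A (reverse B)
AllFar-reverseʳ = All.map All-reverse

induced-reverse : ∀ L → Induced L → Induced (reverse L)
induced-reverse [] _ = tt
induced-reverse (_ ∷ []) _ = tt
induced-reverse (x ∷ y ∷ ys) (d≡1 , fars , ind) =
  subst Induced (sym (unfold-reverse x (y ∷ ys)))
    (induced-++ (reverse (y ∷ ys)) (induced-reverse (y ∷ ys) ind) tt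
      (subst (λ R → Joinable R [ x ]) (sym (unfold-reverse y ys))
        (joinable-++ˡ (reverse ys) (All-reverse (All.map (λ f → Far-sym f ∷ []) fars))
          (trans (dist-comm y x) d≡1 , []))))

induced-isometric : ∀ (g : ℕ → Point) → (∀ i j → dist (g i) (g j) ≡ ∣ i - j ∣) →
  ∀ n → Induced (applyUpTo g n)
induced-isometric g iso 0 = tt
induced-isometric g iso 1 = tt
induced-isometric g iso (suc (suc n)) =
  iso 0 1 ,
  All.applyUpTo⁺₂ (g ∘ suc ∘ suc) n
    (λ j → far (subst (2 ≤_) (sym (iso 0 (2 + j))) (s≤s (s≤s z≤n)))) ,
  induced-isometric (g ∘ suc) (λ i j → iso (suc i) (suc j)) (suc n)

joinable-applyUpTo : ∀ (g : ℕ → Point) n {B} → (∀ k → k < n → All (Far (g k)) B) →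
  Joinable [ g n ] B → Joinable (applyUpTo g (suc n)) B
joinable-applyUpTo g zero _ join = join
joinable-applyUpTo g (suc n) fars join =
  fars 0 z<s , joinable-applyUpTo (g ∘ suc) n (λ k k<n → fars (suc k) (s<s k<n)) join

All-applyUpTo : ∀ {P : Point → Set} (g : ℕ → Point) n → (∀ k → k < n → P (g k)) →
  All P (applyUpTo g n)
All-applyUpTo g n h = All.applyUpTo⁺₁ g n (λ {k} → h k)

-- The offset is added on the left so that a ray at 0 is its base point definitionally.
rayX rayY rayZ : Point → ℕ → Point
rayX (x , y , z) k = (k + x , y , z)
rayY (x , y , z) k = (x , k + y , z)
rayZ (x , y , z) k = (x , y , k + z)

dist-rayX : ∀ p i j → dist (rayX p i) (rayX p j) ≡ ∣ i - j ∣
dist-rayX (x , y , z) i j rewrite ∣i+n-j+n∣≡∣i-j∣ x i j | ∣n-n∣≡0 y | ∣n-n∣≡0 z =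
  trans (+-identityʳ _) (+-identityʳ _)

dist-rayY : ∀ p i j → dist (rayY p i) (rayY p j) ≡ ∣ i - j ∣
dist-rayY (x , y , z) i j rewrite ∣n-n∣≡0 x | ∣i+n-j+n∣≡∣i-j∣ y i j | ∣n-n∣≡0 z =
  +-identityʳ _

dist-rayZ : ∀ p i j → dist (rayZ p i) (rayZ p j) ≡ ∣ i - j ∣
dist-rayZ (x , y , z) i j rewrite ∣n-n∣≡0 x | ∣n-n∣≡0 y | ∣i+n-j+n∣≡∣i-j∣ z i j = refl

module _ (f : Point → Point) (isometry : ∀ a b → dist (f a) (f b) ≡ dist a b) where

  Far-isometry : ∀ {a b} → Far a b → Far (f a) (f b)
  Far-isometry {a} {b} (far le) = far (subst (2 ≤_) (sym (isometry a b)) le)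

  All-Far-isometry : ∀ {a L} → All (Far a) L → All (Far (f a)) (map f L)
  All-Far-isometry fars = All.map⁺ (All.map Far-isometry fars)

  induced-isometry : ∀ L → Induced L → Induced (map f L)
  induced-isometry [] _ = tt
  induced-isometry (_ ∷ []) _ = tt
  induced-isometry (a ∷ b ∷ cs) (d≡1 , fars , ind) =
    trans (isometry a b) d≡1 , All-Far-isometry fars , induced-isometry (b ∷ cs) ind

  joinable-isometry : ∀ A C → Joinable A C → Joinable (map f A) (map f C)
  joinable-isometry [] _ _ = tt
  joinable-isometry (_ ∷ []) [] _ = tt
  joinable-isometry (a ∷ []) (c ∷ cs) (d≡1 , fars) = trans (isometry a c) d≡1 , All-Far-isometry fars
  joinable-isometry (a ∷ a′ ∷ as) C (fars , join) =
    All-Far-isometry fars , joinable-isometry (a′ ∷ as) C join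

shiftX : ℕ → Point → Point
shiftX B (x , y , z) = (B + x , y , z)

dist-shiftX : ∀ B a b → dist (shiftX B a) (shiftX B b) ≡ dist a b
dist-shiftX B (x , y , z) (x′ , y′ , z′) rewrite ∣m+n-m+o∣≡∣n-o∣ B x x′ = refl

far? : ∀ a b → Dec (Far a b)
far? a b = map′ far Far.2≤dist (2 ≤? dist a b)

induced? : ∀ L → Dec (Induced L)
induced? [] = yes tt
induced? (_ ∷ []) = yes tt
induced? (a ∷ b ∷ cs) = (dist a b ≟ 1) ×-dec (All.all? (far? a) cs ×-dec induced? (b ∷ cs))

joinable? : ∀ A B → Dec (Joinable A B)
joinable? [] _ = yes tt
joinable? (_ ∷ []) [] = yes tt
joinable? (a ∷ []) (b ∷ bs) = (dist a b ≟ 1) ×-dec All.all? (far? a) bs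
joinable? (a ∷ a′ ∷ as) B = All.all? (far? a) B ×-dec joinable? (a′ ∷ as) B

allFar? : ∀ A B → Dec (AllFar A B)
allFar? A B = All.all? (λ a → All.all? (far? a) B) A

Port : Set
Port = Fin 6

-- The vertex sits at hub; stub p leads from it to just below socket p, where the column of the
-- edge at port p starts.  The properties required of this data are checked by evaluation below.
hub : Point
hub = (4 , 2 , 2)

stub : Port → List Point
stub fzero = []
stub (fsuc fzero) = (5 , 2 , 2) ∷ (6 , 2 , 2) ∷ []
stub (fsuc (fsuc fzero)) = (3 , 2 , 2) ∷ (2 , 2 , 2) ∷ []
stub (fsuc (fsuc (fsuc fzero))) =
  (4 , 3 , 2) ∷ (4 , 4 , 2) ∷ (5 , 4 , 2) ∷ (6 , 4 , 2) ∷ (7 , 4 , 2) ∷ (8 , 4 , 2) ∷ []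
stub (fsuc (fsuc (fsuc (fsuc fzero)))) =
  (4 , 1 , 2) ∷ (4 , 0 , 2) ∷ (3 , 0 , 2) ∷ (2 , 0 , 2) ∷ (1 , 0 , 2) ∷ (0 , 0 , 2) ∷ []
stub (fsuc (fsuc (fsuc (fsuc (fsuc fzero))))) =
  (4 , 2 , 1) ∷ (4 , 2 , 0) ∷ (5 , 2 , 0) ∷ (6 , 2 , 0) ∷ (7 , 2 , 0) ∷ (8 , 2 , 0) ∷
  (9 , 2 , 0) ∷ (10 , 2 , 0) ∷ (10 , 2 , 1) ∷ (10 , 2 , 2) ∷ []

socketX socketY : Port → ℕ
socketX fzero = 4
socketX (fsuc fzero) = 6
socketX (fsuc (fsuc fzero)) = 2
socketX (fsuc (fsuc (fsuc fzero))) = 8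
socketX (fsuc (fsuc (fsuc (fsuc fzero)))) = 0
socketX (fsuc (fsuc (fsuc (fsuc (fsuc fzero))))) = 10
socketY (fsuc (fsuc (fsuc fzero))) = 4
socketY (fsuc (fsuc (fsuc (fsuc fzero)))) = 0
socketY _ = 2

socket : Port → Point
socket p = (socketX p , socketY p , 3)

InGadgetBox : Point → Set
InGadgetBox u = xc u ≤ 10 × yc u ≤ 4 × zc u ≤ 2

PortFacts : Port → Set
PortFacts p = Induced (hub ∷ stub p) × Joinable (hub ∷ stub p) [ socket p ] ×
  All InGadgetBox (hub ∷ stub p) × socketX p ≤ 10 × socketY p ≤ 4

PortPairFacts : Port → Port → Set
PortPairFacts p p′ = AllFar (stub p) (stub p′) × All (λ u → Far u (socket p′)) (stub p) ×
  2 ≤ ∣ socketX p - socketX p′ ∣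

portFacts : ∀ p → PortFacts p
portFacts = toWitness {a? = Fin.all? portFacts?} tt
  where
  portFacts? : ∀ p → Dec (PortFacts p)
  portFacts? p = induced? _ ×-dec joinable? _ _ ×-dec
    All.all? (λ u → (xc u ≤? 10) ×-dec (yc u ≤? 4) ×-dec (zc u ≤? 2)) _ ×-dec
    (socketX p ≤? 10) ×-dec (socketY p ≤? 4)

private
  portPairTable : ∀ p p′ → p ≡ p′ ⊎ PortPairFacts p p′
  portPairTable = toWitness {a? = Fin.all? λ p → Fin.all? λ p′ →
    (p Fin.≟ p′) ⊎-dec (allFar? _ _ ×-dec All.all? (λ u → far? u _) _ ×-dec (2 ≤? _))} tt

portPairFacts : ∀ p p′ → p ≢ p′ → PortPairFacts p p′
portPairFacts p p′ p≢p′ with portPairTable p p′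
... | inj₁ p≡p′ = ⊥-elim (p≢p′ p≡p′)
... | inj₂ facts = facts

gadget-induced : ∀ p → Induced (hub ∷ stub p)
gadget-induced p = proj₁ (portFacts p)

gadget-joins-socket : ∀ p → Joinable (hub ∷ stub p) [ socket p ]
gadget-joins-socket p = proj₁ (proj₂ (portFacts p))

gadget-in-box : ∀ p → All InGadgetBox (hub ∷ stub p)
gadget-in-box p = proj₁ (proj₂ (proj₂ (portFacts p)))

socketX≤10 : ∀ p → socketX p ≤ 10
socketX≤10 p = proj₁ (proj₂ (proj₂ (proj₂ (portFacts p))))

socketY≤4 : ∀ p → socketY p ≤ 4
socketY≤4 p = proj₂ (proj₂ (proj₂ (proj₂ (portFacts p))))

stubs-far : ∀ {p p′} → p ≢ p′ → AllFar (stub p) (stub p′)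
stubs-far p≢p′ = proj₁ (portPairFacts _ _ p≢p′)

stub-far-socket : ∀ {p p′} → p ≢ p′ → All (λ u → Far u (socket p′)) (stub p)
stub-far-socket p≢p′ = proj₁ (proj₂ (portPairFacts _ _ p≢p′))

socketX-gap : ∀ {p p′} → p ≢ p′ → 2 ≤ ∣ socketX p - socketX p′ ∣
socketX-gap p≢p′ = proj₂ (proj₂ (portPairFacts _ _ p≢p′))

center : ℕ → Point
center B = shiftX B hub

stubAt : ℕ → Port → List Point
stubAt B p = map (shiftX B) (stub p)

column : ℕ → Port → ℕ → List Point
column B p t = applyUpTo (rayZ (shiftX B (socket p))) (suc t)

armLength : Port → ℕ
armLength p = 5 ∸ socketY p

armBase : ℕ → Port → ℕ → Point
armBase B p t = (B + socketX p , socketY p , 4 + t)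

arm : ℕ → Port → ℕ → List Point
arm B p t = applyUpTo (rayY (armBase B p t)) (suc (armLength p))

riser : ℕ → Port → ℕ → List Point
riser B p t = column B p t ++ arm B p t

leg : ℕ → Port → ℕ → List Point
leg B p t = stubAt B p ++ riser B p t

halfPath : ℕ → Port → ℕ → List Point
halfPath B p t = center B ∷ leg B p t

gadgetAt-z≤2 : ∀ B p → All (λ u → zc u ≤ 2) (map (shiftX B) (hub ∷ stub p))
gadgetAt-z≤2 B p = All.map⁺ (All.map (proj₂ ∘ proj₂) (gadget-in-box p))

riser-above-socket-z : ∀ B p t →
  All (λ u → 4 ≤ zc u) (applyUpTo (rayZ (shiftX B (socket p)) ∘ suc) t ++ arm B p t)
riser-above-socket-z B p t = All.++⁺
  (All-applyUpTo (rayZ (shiftX B (socket p)) ∘ suc) t (λ k _ → s≤s (m≤n+m 3 k)))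
  (All-applyUpTo (rayY (armBase B p t)) (suc (armLength p)) (λ _ _ → m≤m+n 4 t))

column-induced : ∀ B p t → Induced (column B p t)
column-induced B p t =
  induced-isometric (rayZ (shiftX B (socket p))) (dist-rayZ (shiftX B (socket p))) (suc t)

arm-induced : ∀ B p t → Induced (arm B p t)
arm-induced B p t =
  induced-isometric (rayY (armBase B p t)) (dist-rayY (armBase B p t)) (suc (armLength p))

column-joins-arm : ∀ B p t → Joinable (column B p t) (arm B p t)
column-joins-arm B p t = joinable-applyUpTo (rayZ (shiftX B (socket p))) t below top-joins
  where
  below : ∀ k → k < t → All (Far (rayZ (shiftX B (socket p)) k)) (arm B p t)
  below k k<t = All-applyUpTo (rayY (armBase B p t)) (suc (armLength p)) λ _ _ →
    Far-z< (≤-trans (≤-reflexive (trans (+-assoc k 3 2) (+-comm k 5)))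
                    (s≤s (s≤s (s≤s (s≤s k<t)))))
  top-joins : Joinable [ rayZ (shiftX B (socket p)) t ] (arm B p t)
  top-joins =
    subst (λ z → dist (B + socketX p , socketY p , t + 3) (B + socketX p , socketY p , z) ≡ 1)
      (trans (sym (+-suc t 3)) (+-comm t 4))
      (dist-step-z (B + socketX p) (socketY p) (t + 3)) ,
    All-applyUpTo (rayY (armBase B p t) ∘ suc) (armLength p) λ k _ →
      Far-yz (m+n≤o⇒n≤∣m-o∣ (socketY p) 1 (suc k + socketY p)
               (m+1≤1+n+m (socketY p) k))
             (m+n≤o⇒n≤∣m-o∣ (t + 3) 1 (4 + t)
               (≤-reflexive (trans (+-assoc t 3 1) (+-comm t 4))))

riser-induced : ∀ B p t → Induced (riser B p t)
riser-induced B p t =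
  induced-++ (column B p t) (column-induced B p t) (arm-induced B p t) (column-joins-arm B p t)

halfPath-induced : ∀ B p t → Induced (halfPath B p t)
halfPath-induced B p t =
  induced-++ (map (shiftX B) (hub ∷ stub p))
    (induced-isometry (shiftX B) (dist-shiftX B) (hub ∷ stub p) (gadget-induced p))
    (riser-induced B p t)
    (joinable-++ʳ (map (shiftX B) (hub ∷ stub p))
      (joinable-isometry (shiftX B) (dist-shiftX B) (hub ∷ stub p) [ socket p ]
        (gadget-joins-socket p))
      (AllFar-by (gadgetAt-z≤2 B p) (riser-above-socket-z B p t)
        (λ z≤2 4≤z → Far-z< (≤-trans (+-monoˡ-≤ 2 z≤2) 4≤z))))

armTop : ℕ → Port → ℕ → Point
armTop B p t = rayY (armBase B p t) (armLength p)

armTop-y : ∀ B p t → yc (armTop B p t) ≡ 5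
armTop-y B p t = m∸n+n≡m (≤-trans (socketY≤4 p) (n≤1+n 4))

halfFront : ℕ → Port → ℕ → List Point
halfFront B p t =
  center B ∷ stubAt B p ++ column B p t ++ applyUpTo (rayY (armBase B p t)) (armLength p)

halfPath-snoc : ∀ B p t → halfPath B p t ≡ halfFront B p t ∷ʳ armTop B p t
halfPath-snoc B p t = cong (center B ∷_) (begin
  stubAt B p ++ column B p t ++ arm B p t
    ≡⟨ cong (λ A → stubAt B p ++ column B p t ++ A)
            (sym (applyUpTo-∷ʳ (rayY (armBase B p t)) (armLength p))) ⟩
  stubAt B p ++ column B p t ++ (armFront ∷ʳ armTop B p t)
    ≡⟨ cong (stubAt B p ++_) (sym (++-assoc (column B p t) armFront [ armTop B p t ])) ⟩
  stubAt B p ++ (column B p t ++ armFront) ∷ʳ armTop B p t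
    ≡⟨ sym (++-assoc (stubAt B p) (column B p t ++ armFront) [ armTop B p t ]) ⟩
  (stubAt B p ++ column B p t ++ armFront) ∷ʳ armTop B p t ∎)
  where
  open ≡-Reasoning
  armFront = applyUpTo (rayY (armBase B p t)) (armLength p)

halfFront-y≤4 : ∀ B p t → All (λ u → yc u ≤ 4) (halfFront B p t)
halfFront-y≤4 B p t =
  All.++⁺ (All.map⁺ (All.map (proj₁ ∘ proj₂) (gadget-in-box p)))
    (All.++⁺ (All-applyUpTo (rayZ (shiftX B (socket p))) (suc t) (λ _ _ → socketY≤4 p))
             (All-applyUpTo (rayY (armBase B p t)) (armLength p) below-top))
  where
  below-top : ∀ k → k < armLength p → k + socketY p ≤ 4
  below-top k k<L =
    ≤-pred (subst (suc k + socketY p ≤_) (armTop-y B p t) (+-monoˡ-≤ (socketY p) k<L))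

InBlock : ℕ → Point → Set
InBlock B u = B ≤ xc u × xc u ≤ B + 10

halfPath-inBlock : ∀ B p t → All (InBlock B) (halfPath B p t)
halfPath-inBlock B p t =
  All.++⁺ (All.map⁺ (All.map (λ box → m≤m+n B _ , +-monoʳ-≤ B (proj₁ box)) (gadget-in-box p)))
          (All.++⁺ (All-applyUpTo (rayZ (shiftX B (socket p))) (suc t) (λ _ _ → inRiser))
                   (All-applyUpTo (rayY (armBase B p t)) (suc (armLength p)) (λ _ _ → inRiser)))
  where
  inRiser : B ≤ B + socketX p × B + socketX p ≤ B + 10
  inRiser = m≤m+n B _ , +-monoʳ-≤ B (socketX≤10 p)

blocks-far : ∀ {B B′} → B + 12 ≤ B′ → ∀ {a b} → InBlock B a → InBlock B′ b → Far a b
blocks-far {B} {B′} gap (_ , a≤) (≤b , _) =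
  Far-x< (≤-trans (+-monoˡ-≤ 2 a≤) (≤-trans (≤-reflexive (+-assoc B 10 2)) (≤-trans gap ≤b)))

halfPaths-far : ∀ {B B′} → B + 12 ≤ B′ → ∀ p t q t′ →
  AllFar (halfPath B p t) (halfPath B′ q t′)
halfPaths-far gap p t q t′ =
  AllFar-by (halfPath-inBlock _ p t) (halfPath-inBlock _ q t′) (blocks-far gap)

bridge : ℕ → ℕ → ℕ → List Point
bridge cu cv t = applyUpTo (rayX (cu , 6 , 4 + t)) (suc (cv ∸ cu))

bridge-level : ∀ cu cv t → All (λ b → yc b ≡ 6 × zc b ≡ 4 + t) (bridge cu cv t)
bridge-level cu cv t = All-applyUpTo (rayX (cu , 6 , 4 + t)) (suc (cv ∸ cu)) (λ _ _ → refl , refl)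

bridge-induced : ∀ cu cv t → Induced (bridge cu cv t)
bridge-induced cu cv t =
  induced-isometric (rayX (cu , 6 , 4 + t)) (dist-rayX (cu , 6 , 4 + t)) (suc (cv ∸ cu))

halfFront-far-bridge : ∀ B p t cu cv t′ → AllFar (halfFront B p t) (bridge cu cv t′)
halfFront-far-bridge B p t cu cv t′ = AllFar-by (halfFront-y≤4 B p t) (bridge-level cu cv t′)
  λ { {_} {_ , _ , _} y≤4 (refl , _) → Far-y< (+-monoˡ-≤ 2 y≤4) }

1≤∣armTop-y-6∣ : ∀ B p t → 1 ≤ ∣ yc (armTop B p t) - 6 ∣
1≤∣armTop-y-6∣ B p t rewrite armTop-y B p t = s≤s z≤n

halfPath-joins-bridge : ∀ B p t cv → Joinable (halfPath B p t) (bridge (B + socketX p) cv t)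
halfPath-joins-bridge B p t cv = subst (λ H → Joinable H X) (sym (halfPath-snoc B p t))
  (joinable-++ˡ (halfFront B p t) (halfFront-far-bridge B p t cu cv t)
    ( subst (λ y → dist (cu , y , 4 + t) (cu , 6 , 4 + t) ≡ 1) (sym (armTop-y B p t))
        (dist-step-y cu 5 (4 + t))
    , All-applyUpTo (rayX (cu , 6 , 4 + t) ∘ suc) (cv ∸ cu) λ k _ →
        Far-xy (m+n≤o⇒n≤∣m-o∣ cu 1 (suc k + cu) (m+1≤1+n+m cu k)) (1≤∣armTop-y-6∣ B p t)))
  where
  cu = B + socketX p
  X = bridge cu cv t

bridge-joins-armTop : ∀ {cu} B p t → cu ≤ B + socketX p →
  Joinable (bridge cu (B + socketX p) t) [ armTop B p t ]
bridge-joins-armTop {cu} B p t cu≤cv = joinable-applyUpTo (rayX (cu , 6 , 4 + t)) (cv ∸ cu)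
  (λ k k<m → Far-xy (m+n≤o⇒n≤∣m-o∣ (k + cu) 1 cv
                      (≤-trans (≤-reflexive (+-comm (k + cu) 1))
                               (m≤o∸n⇒m+n≤o (suc k) cu≤cv k<m)))
                    (subst (1 ≤_) (∣-∣-comm (yc (armTop B p t)) 6) (1≤∣armTop-y-6∣ B p t)) ∷ [])
  (last-adjacent , [])
  where
  cv = B + socketX p
  last-adjacent : dist (rayX (cu , 6 , 4 + t) (cv ∸ cu)) (armTop B p t) ≡ 1
  last-adjacent rewrite m∸n+n≡m cu≤cv | armTop-y B p t =
    trans (dist-comm (cv , 6 , 4 + t) (cv , 5 , 4 + t)) (dist-step-y cv 5 (4 + t))

bridge-joins-reverse-halfPath : ∀ {cu} B p t → cu ≤ B + socketX p →
  Joinable (bridge cu (B + socketX p) t) (reverse (halfPath B p t))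
bridge-joins-reverse-halfPath {cu} B p t cu≤cv =
  subst (Joinable X) (sym (trans (cong reverse (halfPath-snoc B p t)) (reverse-++ (halfFront B p t) _)))
    (joinable-++ʳ X (bridge-joins-armTop B p t cu≤cv)
      (AllFar-reverseʳ (AllFar-sym (halfFront-far-bridge B p t cu (B + socketX p) t))))
  where
  X = bridge cu (B + socketX p) t

edgePath : ℕ → Port → ℕ → Port → ℕ → List Point
edgePath B p B′ q t =
  halfPath B p t ++ bridge (B + socketX p) (B′ + socketX q) t ++ reverse (halfPath B′ q t)

edgePath-induced : ∀ {B B′} → B + 12 ≤ B′ → ∀ p q t → Induced (edgePath B p B′ q t)
edgePath-induced {B} {B′} gap p q t =
  induced-++ (halfPath B p t) (halfPath-induced B p t)
    (induced-++ (bridge cu cv t) (bridge-induced cu cv t) (induced-reverse _ (halfPath-induced B′ q t))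
      (bridge-joins-reverse-halfPath B′ q t cu≤cv))
    (joinable-++ʳ (halfPath B p t) (halfPath-joins-bridge B p t cv)
      (AllFar-reverseʳ (halfPaths-far gap p t q t)))
  where
  cu = B + socketX p
  cv = B′ + socketX q
  cu≤cv : cu ≤ cv
  cu≤cv = ≤-trans (+-monoʳ-≤ B (socketX≤10 p)) (≤-trans (m≤m+n (B + 10) 2)
            (≤-trans (≤-reflexive (+-assoc B 10 2)) (≤-trans gap (m≤m+n B′ _))))

edgeInterior : ℕ → Port → ℕ → Port → ℕ → List Point
edgeInterior B p B′ q t =
  leg B p t ++ bridge (B + socketX p) (B′ + socketX q) t ++ reverse (leg B′ q t)

edgePath-shape : ∀ B p B′ q t →
  edgePath B p B′ q t ≡ center B ∷ edgeInterior B p B′ q t ∷ʳ center B′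
edgePath-shape B p B′ q t = cong (center B ∷_) (begin
  L ++ X ++ reverse (center B′ ∷ L′)   ≡⟨ cong (L ++_) (cong (X ++_) (unfold-reverse _ L′)) ⟩
  L ++ X ++ reverse L′ ∷ʳ center B′     ≡⟨ cong (L ++_) (sym (++-assoc X (reverse L′) _)) ⟩
  L ++ (X ++ reverse L′) ∷ʳ center B′   ≡⟨ sym (++-assoc L (X ++ reverse L′) _) ⟩
  (L ++ X ++ reverse L′) ∷ʳ center B′   ∎)
  where
  open ≡-Reasoning
  L = leg B p t
  L′ = leg B′ q t
  X = bridge (B + socketX p) (B′ + socketX q) t

leg-distinct-center : ∀ B p t → All (_≢ center B) (leg B p t)
leg-distinct-center B p t = induced-head-distinct (leg B p t) (halfPath-induced B p t)

center-inBlock : ∀ B → InBlock B (center B)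
center-inBlock B = m≤m+n B 4 , +-monoʳ-≤ B (s≤s (s≤s (s≤s (s≤s z≤n))))

leg-inBlock : ∀ B p t → All (InBlock B) (leg B p t)
leg-inBlock B p t = All.tail (halfPath-inBlock B p t)

leg-far-center : ∀ {B B′} → B + 12 ≤ B′ ⊎ B′ + 12 ≤ B → ∀ p t →
  All (λ x → Far x (center B′)) (leg B p t)
leg-far-center (inj₁ gap) p t =
  All.map (λ inB → blocks-far gap inB (center-inBlock _)) (leg-inBlock _ p t)
leg-far-center (inj₂ gap) p t =
  All.map (λ inB → Far-sym (blocks-far gap (center-inBlock _) inB)) (leg-inBlock _ p t)

legs-far-blocks : ∀ {B B′} → B + 12 ≤ B′ → ∀ p t p′ t′ → AllFar (leg B p t) (leg B′ p′ t′)
legs-far-blocks gap p t p′ t′ =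
  AllFar-by (leg-inBlock _ p t) (leg-inBlock _ p′ t′) (blocks-far gap)

centers-far : ∀ {B B′} → B + 12 ≤ B′ → Far (center B) (center B′)
centers-far gap = blocks-far gap (center-inBlock _) (center-inBlock _)

riser-x : ∀ B p t → All (λ u → xc u ≡ B + socketX p) (riser B p t)
riser-x B p t = All.++⁺ (All-applyUpTo (rayZ (shiftX B (socket p))) (suc t) (λ _ _ → refl))
                        (All-applyUpTo (rayY (armBase B p t)) (suc (armLength p)) (λ _ _ → refl))

stubAt-far-riser : ∀ B {p p′} t′ → p ≢ p′ → AllFar (stubAt B p) (riser B p′ t′)
stubAt-far-riser B {p} {p′} t′ p≢p′ =
  All.map (λ (f , z≤2) → f ∷ All.map (λ 4≤z → Far-z< (≤-trans (+-monoˡ-≤ 2 z≤2) 4≤z))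
                                     (riser-above-socket-z B p′ t′))
    (All.zip (All.map⁺ (All.map (Far-isometry (shiftX B) (dist-shiftX B)) (stub-far-socket p≢p′)) ,
              All.tail (gadgetAt-z≤2 B p)))

legs-far-same-block : ∀ B {p p′} t t′ → p ≢ p′ → AllFar (leg B p t) (leg B p′ t′)
legs-far-same-block B {p} {p′} t t′ p≢p′ =
  All.++⁺ (AllFar-++ʳ stubs-far-shifted (stubAt-far-riser B t′ p≢p′))
          (AllFar-++ʳ (AllFar-sym (stubAt-far-riser B t (p≢p′ ∘ sym))) risers-far)
  where
  stubs-far-shifted : AllFar (stubAt B p) (stubAt B p′)
  stubs-far-shifted =
    All.map⁺ (All.map (All-Far-isometry (shiftX B) (dist-shiftX B)) (stubs-far p≢p′))
  risers-far : AllFar (riser B p t) (riser B p′ t′)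
  risers-far = AllFar-by (riser-x B p t) (riser-x B p′ t′) λ { {_ , _ , _} {_ , _ , _} refl refl →
    Far-x (subst (2 ≤_) (sym (∣m+n-m+o∣≡∣n-o∣ B (socketX p) (socketX p′)))
                 (socketX-gap p≢p′)) }

level-gap : ∀ {t t′} → 2 ≤ ∣ t - t′ ∣ → 2 ≤ ∣ 4 + t - (4 + t′) ∣
level-gap {t} {t′} = subst (2 ≤_) (sym (∣m+n-m+o∣≡∣n-o∣ 4 t t′))

leg-far-bridge : ∀ B p {t t′} cu cv → 2 ≤ ∣ t - t′ ∣ → AllFar (leg B p t) (bridge cu cv t′)
leg-far-bridge B p {t} {t′} cu cv t-gap =
  All.++⁺ (AllFar-by (All.tail (gadgetAt-z≤2 B p)) X-level
             λ { {_} {_ , _ , _} z≤2 (_ , refl) →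
                   Far-z< (≤-trans (+-monoˡ-≤ 2 z≤2) (m≤m+n 4 t′)) })
  (All.++⁺ (AllFar-by column-y X-level
             λ { {_} {_ , _ , _} y≤4 (refl , _) → Far-y< (+-monoˡ-≤ 2 y≤4) })
           (AllFar-by arm-z X-level
             λ { {_ , _ , _} {_ , _ , _} refl (_ , refl) → Far-z (level-gap {t} {t′} t-gap) }))
  where
  X-level = bridge-level cu cv t′
  column-y : All (λ u → yc u ≤ 4) (column B p t)
  column-y = All-applyUpTo (rayZ (shiftX B (socket p))) (suc t) (λ _ _ → socketY≤4 p)
  arm-z : All (λ u → zc u ≡ 4 + t) (arm B p t)
  arm-z = All-applyUpTo (rayY (armBase B p t)) (suc (armLength p)) (λ _ _ → refl)

bridge-far-center : ∀ cu cv t B → All (λ x → Far x (center B)) (bridge cu cv t)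
bridge-far-center cu cv t B =
  All.map (λ { {_ , _ , _} (_ , refl) → Far-sym (Far-z< (m≤m+n 4 t)) }) (bridge-level cu cv t)

bridges-far : ∀ {t t′} cu cv cu′ cv′ → 2 ≤ ∣ t - t′ ∣ →
  AllFar (bridge cu cv t) (bridge cu′ cv′ t′)
bridges-far {t} {t′} cu cv cu′ cv′ t-gap =
  AllFar-by (bridge-level cu cv _) (bridge-level cu′ cv′ _)
  λ { {_ , _ , _} {_ , _ , _} (_ , refl) (_ , refl) → Far-z (level-gap {t} {t′} t-gap) }

module _ {n : ℕ} where

  countTrue : (Fin n → Bool) → List (Fin n) → ℕ
  countTrue P us = sum (map (λ u → if P u then 1 else 0) us)

  module _ {P Q : Fin n → Bool} (P⇒Q : ∀ u → P u ≡ true → Q u ≡ true) where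

    countTrue-mono : ∀ us → countTrue P us ≤ countTrue Q us
    countTrue-mono [] = z≤n
    countTrue-mono (u ∷ us) with P u in Pu | Q u in Qu
    ... | true  | true  = s≤s (countTrue-mono us)
    ... | true  | false = contradiction (trans (sym (P⇒Q u Pu)) Qu) λ ()
    ... | false | true  = m≤n⇒m≤1+n (countTrue-mono us)
    ... | false | false = countTrue-mono us

    countTrue-strictMono : ∀ {w us} → w ∈ us → P w ≡ false → Q w ≡ true →
      countTrue P us < countTrue Q us
    countTrue-strictMono {us = u ∷ us} (here refl) Pw Qw rewrite Pw | Qw = s≤s (countTrue-mono us)
    countTrue-strictMono {us = u ∷ us} (there w∈) Pw Qw with P u in Pu | Q u in Qu
    ... | true  | true  = s≤s (countTrue-strictMono w∈ Pw Qw)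
    ... | true  | false = contradiction (trans (sym (P⇒Q u Pu)) Qu) λ ()
    ... | false | true  = m≤n⇒m≤1+n (countTrue-strictMono w∈ Pw Qw)
    ... | false | false = countTrue-strictMono w∈ Pw Qw

module PortAssignment {n : ℕ} (G : Graph n) (max-degree : MaxDegreeAtMost G 6) where

  neighbourBelow : Fin n → Fin n → Fin n → Bool
  neighbourBelow w z u = E G w u ∧ does (u Fin.<? z)

  rank : Fin n → Fin n → ℕ
  rank w z = countTrue (neighbourBelow w z) (allFin n)

  private
    does-true : ∀ {A : Set} (a? : Dec A) → does a? ≡ true → A
    does-true (yes a) _ = a

    not-below-self : ∀ {w z} → E G w z ≡ true → neighbourBelow w z z ≡ false
    not-below-self {z = z} adj =
      trans (cong (_∧ does (z Fin.<? z)) adj) (dec-false (z Fin.<? z) (<-irrefl refl))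

  rank<6 : ∀ {w z} → E G w z ≡ true → rank w z < 6
  rank<6 {w} {z} adj =
    ≤-trans (countTrue-strictMono (λ u → Bool.∧-conicalˡ _ _) (∈-allFin z) (not-below-self adj) adj)
            (max-degree w)

  rank-strictMono : ∀ {w z z′} → E G w z ≡ true → toℕ z < toℕ z′ → rank w z < rank w z′
  rank-strictMono {w} {z} {z′} adj z<z′ =
    countTrue-strictMono below-z⇒below-z′ (∈-allFin z) (not-below-self adj)
      (trans (cong (_∧ does (z Fin.<? z′)) adj) (dec-true (z Fin.<? z′) z<z′))
    where
    below-z⇒below-z′ : ∀ u → neighbourBelow w z u ≡ true → neighbourBelow w z′ u ≡ true
    below-z⇒below-z′ u eq = cong₂ _∧_ (Bool.∧-conicalˡ _ _ eq)
      (dec-true (u Fin.<? z′) (<-trans (does-true (u Fin.<? z) (Bool.∧-conicalʳ _ _ eq)) z<z′))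

  rank-injective : ∀ {w z z′} → E G w z ≡ true → E G w z′ ≡ true →
    rank w z ≡ rank w z′ → z ≡ z′
  rank-injective {w} {z} {z′} adj adj′ eq with <-cmp (toℕ z) (toℕ z′)
  ... | tri< z<z′ _ _ = contradiction eq (<⇒≢ (rank-strictMono adj z<z′))
  ... | tri≈ _ z≡z′ _ = Fin.toℕ-injective z≡z′
  ... | tri> _ _ z′<z = contradiction (sym eq) (<⇒≢ (rank-strictMono adj′ z′<z))

  port : ∀ w z → E G w z ≡ true → Port
  port w z adj = Fin.fromℕ< (rank<6 adj)

  port-injective : ∀ {w z z′} (adj : E G w z ≡ true) (adj′ : E G w z′ ≡ true) →
    port w z adj ≡ port w z′ adj′ → z ≡ z′
  port-injective adj adj′ eq = rank-injective adj adj′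
    (trans (sym (Fin.toℕ-fromℕ< (rank<6 adj)))
           (trans (cong toℕ eq) (Fin.toℕ-fromℕ< (rank<6 adj′))))

data Side : Set where
  src tgt : Side

opposite : Side → Side
opposite src = tgt
opposite tgt = src

module Edges {n : ℕ} (G : Graph n) where

  endpoint : Edge G → Side → Fin n
  endpoint ((u , _) , _) src = u
  endpoint ((_ , v) , _) tgt = v

  endpoint-adjacent : ∀ e s → E G (endpoint e s) (endpoint e (opposite s)) ≡ true
  endpoint-adjacent (_ , _ , adj) src = adj
  endpoint-adjacent ((u , v) , _ , adj) tgt = trans (Graph.sym G v u) adj

  edge-≡ : ∀ {e e′} → endpoint e src ≡ endpoint e′ src → endpoint e tgt ≡ endpoint e′ tgt →
    e ≡ e′
  edge-≡ {(u , v) , u<v , adj} {(.u , .v) , u<v′ , adj′} refl refl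
    rewrite ≤-irrelevant u<v u<v′ | Decidable⇒UIP.≡-irrelevant Bool._≟_ adj adj′ = refl

  _≟ₑ_ : DecidableEquality (Edge G)
  e ≟ₑ e′ with endpoint e src Fin.≟ endpoint e′ src | endpoint e tgt Fin.≟ endpoint e′ tgt
  ... | yes u≡u′ | yes v≡v′ = yes (edge-≡ u≡u′ v≡v′)
  ... | no u≢u′ | _ = no (u≢u′ ∘ cong (λ e → endpoint e src))
  ... | yes _ | no v≢v′ = no (v≢v′ ∘ cong (λ e → endpoint e tgt))

  height : Edge G → ℕ
  height e = 2 * toℕ (Fin.combine (endpoint e src) (endpoint e tgt))

  heights-apart : ∀ {e e′} → e ≢ e′ → 2 ≤ ∣ height e - height e′ ∣
  heights-apart {e} {e′} e≢e′ =
    subst (2 ≤_) (*-distribˡ-∣-∣ 2 c c′) (*-monoʳ-≤ 2 (≢⇒1≤∣-∣ c≢c′))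
    where
    c = toℕ (Fin.combine (endpoint e src) (endpoint e tgt))
    c′ = toℕ (Fin.combine (endpoint e′ src) (endpoint e′ tgt))
    c≢c′ : c ≢ c′
    c≢c′ eq = e≢e′ (uncurry edge-≡ (Fin.combine-injective _ _ _ _ (Fin.toℕ-injective eq)))
    ≢⇒1≤∣-∣ : ∀ {a b} → a ≢ b → 1 ≤ ∣ a - b ∣
    ≢⇒1≤∣-∣ {a} {b} a≢b with ∣ a - b ∣ in eq
    ... | zero = contradiction (∣m-n∣≡0⇒m≡n eq) a≢b
    ... | suc _ = s≤s z≤n

module Drawing {n : ℕ} (G : Graph n) (max-degree : MaxDegreeAtMost G 6) (colour : Fin n → Bool) where

  open Edges G
  open PortAssignment G max-degree

  bit : Fin n → ℕ
  bit w = if colour w then 1 else 0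

  bit≤1 : ∀ w → bit w ≤ 1
  bit≤1 w with colour w
  ... | true = ≤-refl
  ... | false = z≤n

  -- The colour bit shifts the whole block by one, which fixes the parity of the vertex point.
  block : Fin n → ℕ
  block w = 16 * toℕ w + bit w

  block-gap : ∀ {w w′} → toℕ w < toℕ w′ → block w + 12 ≤ block w′
  block-gap {w} {w′} w<w′ = begin
    16 * toℕ w + bit w + 12   ≤⟨ +-monoˡ-≤ 12 (+-monoʳ-≤ (16 * toℕ w) (bit≤1 w)) ⟩
    16 * toℕ w + 1 + 12       ≤⟨ m≤m+n _ 3 ⟩
    16 * toℕ w + 1 + 12 + 3   ≡⟨ 16k+1+12+3≡16[1+k] (toℕ w) ⟩
    16 * suc (toℕ w)          ≤⟨ *-monoʳ-≤ 16 w<w′ ⟩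
    16 * toℕ w′               ≤⟨ m≤m+n _ (bit w′) ⟩
    block w′                  ∎
    where
    open ≤-Reasoning
    16k+1+12+3≡16[1+k] : ∀ k → 16 * k + 1 + 12 + 3 ≡ 16 * suc k
    16k+1+12+3≡16[1+k] = solve-∀

  blocks-apart : ∀ {w w′} → w ≢ w′ → block w + 12 ≤ block w′ ⊎ block w′ + 12 ≤ block w
  blocks-apart {w} {w′} w≢w′ with <-cmp (toℕ w) (toℕ w′)
  ... | tri< w<w′ _ _ = inj₁ (block-gap w<w′)
  ... | tri≈ _ w≡w′ _ = contradiction (Fin.toℕ-injective w≡w′) w≢w′
  ... | tri> _ _ w′<w = inj₂ (block-gap w′<w)

  portAt : Edge G → Side → Port
  portAt e s = port (endpoint e s) (endpoint e (opposite s)) (endpoint-adjacent e s)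

  half-edge-injective : ∀ {e e′} s s′ → endpoint e s ≡ endpoint e′ s′ →
    portAt e s ≡ portAt e′ s′ → e ≡ e′
  half-edge-injective {e@((u , _) , _)} {e′@((.u , _) , _)} src src refl eq =
    edge-≡ refl (port-injective (endpoint-adjacent e src) (endpoint-adjacent e′ src) eq)
  half-edge-injective {e@((_ , v) , _)} {e′@((_ , .v) , _)} tgt tgt refl eq =
    edge-≡ (port-injective (endpoint-adjacent e tgt) (endpoint-adjacent e′ tgt) eq) refl
  half-edge-injective {e@((u , _) , u<v , _)} {e′@((_ , .u) , u′<v′ , _)} src tgt refl eq
    with refl ← port-injective (endpoint-adjacent e src) (endpoint-adjacent e′ tgt) eq =
    contradiction u<v (<-asym u′<v′)
  half-edge-injective {e@((_ , v) , u<v , _)} {e′@((.v , _) , u′<v′ , _)} tgt src refl eq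
    with refl ← port-injective (endpoint-adjacent e tgt) (endpoint-adjacent e′ src) eq =
    contradiction u<v (<-asym u′<v′)

  vertexPoint : Fin n → Point
  vertexPoint w = center (block w)

  legAt : Edge G → Side → List Point
  legAt e s = leg (block (endpoint e s)) (portAt e s) (height e)

  bridgeAt : Edge G → List Point
  bridgeAt e = bridge (block (endpoint e src) + socketX (portAt e src))
                      (block (endpoint e tgt) + socketX (portAt e tgt)) (height e)

  interiorAt : Edge G → List Point
  interiorAt e = legAt e src ++ bridgeAt e ++ reverse (legAt e tgt)

  path-induced : ∀ e →
    Induced (vertexPoint (endpoint e src) ∷ interiorAt e ∷ʳ vertexPoint (endpoint e tgt))
  path-induced e@(_ , u<v , _) =
    subst Induced (edgePath-shape _ (portAt e src) _ (portAt e tgt) (height e))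
      (edgePath-induced (block-gap u<v) (portAt e src) (portAt e tgt) (height e))

  open Properness (SameEdge {G = G}) (refl , refl) _≟ₑ_
    (λ e → vertexPoint (endpoint e src)) (λ e → vertexPoint (endpoint e tgt)) interiorAt path-induced

  isEnd⇒vertex : ∀ {e y} → IsEnd e y → ∃[ s ] y ≡ vertexPoint (endpoint e s)
  isEnd⇒vertex (inj₁ eq) = src , eq
  isEnd⇒vertex (inj₂ eq) = tgt , eq

  vertex-isEnd : ∀ e s → IsEnd e (vertexPoint (endpoint e s))
  vertex-isEnd e src = inj₁ refl
  vertex-isEnd e tgt = inj₂ refl

  ∈interiorAt⇒ : ∀ {e x} → x ∈ interiorAt e → (∃[ s ] x ∈ legAt e s) ⊎ x ∈ bridgeAt e
  ∈interiorAt⇒ {e} x∈ with ∈-++⁻ (legAt e src) x∈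
  ... | inj₁ x∈L = inj₁ (src , x∈L)
  ... | inj₂ x∈R with ∈-++⁻ (bridgeAt e) x∈R
  ...   | inj₁ x∈X = inj₂ x∈X
  ...   | inj₂ x∈L′ = inj₁ (tgt , Any.reverse⁻ x∈L′)

  ∈path⇒ : ∀ {e y} → y ∈ path e →
    (∃[ s ] y ≡ vertexPoint (endpoint e s)) ⊎ (∃[ s ] y ∈ legAt e s) ⊎ y ∈ bridgeAt e
  ∈path⇒ {e} y∈ with ∈path⇒end⊎interior {e} y∈
  ... | inj₁ y-end = inj₁ (isEnd⇒vertex {e} y-end)
  ... | inj₂ y∈I = inj₂ (∈interiorAt⇒ y∈I)

  vertices-not-adjacent : ∀ w w′ → dist (vertexPoint w) (vertexPoint w′) ≢ 1
  vertices-not-adjacent w w′ with w Fin.≟ w′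
  ... | yes refl = 0≢1+n ∘ trans (sym (dist-self (vertexPoint w)))
  ... | no w≢w′ with blocks-apart w≢w′
  ...   | inj₁ gap = Far⇒dist≢1 (centers-far gap)
  ...   | inj₂ gap = Far⇒dist≢1 (Far-sym (centers-far gap))

  ends-not-adjacent : ∀ e e′ {a b} → IsEnd e a → IsEnd e′ b → dist a b ≢ 1
  ends-not-adjacent e e′ a-end b-end with isEnd⇒vertex {e} a-end | isEnd⇒vertex {e′} b-end
  ... | s , refl | s′ , refl = vertices-not-adjacent (endpoint e s) (endpoint e′ s′)

  legs-far : ∀ {e e′} → e ≢ e′ → ∀ s s′ → AllFar (legAt e s) (legAt e′ s′)
  legs-far {e} {e′} e≢e′ s s′ with endpoint e s Fin.≟ endpoint e′ s′
  ... | yes w≡w′ =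
    subst (λ w → AllFar (leg (block w) (portAt e s) (height e)) (legAt e′ s′)) (sym w≡w′)
      (legs-far-same-block _ (height e) (height e′) (e≢e′ ∘ half-edge-injective s s′ w≡w′))
  ... | no w≢w′ with blocks-apart w≢w′
  ...   | inj₁ gap = legs-far-blocks gap _ _ _ _
  ...   | inj₂ gap = AllFar-sym (legs-far-blocks gap _ _ _ _)

  leg-separated : ∀ {e e′} → e ≢ e′ → ∀ {s x y} → x ∈ legAt e s → y ∈ path e′ →
    Far x y ⊎ (IsEnd e y × x ≢ y)
  leg-separated {e} {e′} e≢e′ {s} {x} x∈ y∈ with ∈path⇒ {e′} y∈
  ... | inj₁ (s′ , refl) with endpoint e s Fin.≟ endpoint e′ s′
  ...   | yes w≡w′ = inj₂ (subst (λ w → IsEnd e (vertexPoint w) × x ≢ vertexPoint w) w≡w′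
                             (vertex-isEnd e s , All.lookup (leg-distinct-center _ _ _) x∈))
  ...   | no w≢w′ = inj₁ (All.lookup (leg-far-center (blocks-apart w≢w′) _ _) x∈)
  leg-separated e≢e′ {s} x∈ y∈ | inj₂ (inj₁ (s′ , y∈L′)) =
    inj₁ (All.lookup (All.lookup (legs-far e≢e′ s s′) x∈) y∈L′)
  leg-separated e≢e′ x∈ y∈ | inj₂ (inj₂ y∈X′) =
    inj₁ (All.lookup (All.lookup (leg-far-bridge _ _ _ _ (heights-apart e≢e′)) x∈) y∈X′)

  bridge-separated : ∀ {e e′} → e ≢ e′ → ∀ {x y} → x ∈ bridgeAt e → y ∈ path e′ →
    Far x y
  bridge-separated {e} {e′} e≢e′ x∈ y∈ with ∈path⇒ {e′} y∈
  ... | inj₁ (_ , refl) = All.lookup (bridge-far-center _ _ _ _) x∈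
  ... | inj₂ (inj₁ (_ , y∈L′)) =
    Far-sym (All.lookup (All.lookup (leg-far-bridge _ _ _ _ (heights-apart (e≢e′ ∘ sym))) y∈L′)
                        x∈)
  ... | inj₂ (inj₂ y∈X′) =
    All.lookup (All.lookup (bridges-far _ _ _ _ (heights-apart e≢e′)) x∈) y∈X′

  separated : ∀ {e e′} → e ≢ e′ → ∀ {x y} → x ∈ interiorAt e → y ∈ path e′ →
    Far x y ⊎ (IsEnd e y × x ≢ y)
  separated {e} e≢e′ x∈ y∈ with ∈interiorAt⇒ {e} x∈
  ... | inj₁ (s , x∈L) = leg-separated e≢e′ {s} x∈L y∈
  ... | inj₂ x∈X = inj₁ (bridge-separated e≢e′ x∈X y∈)

  vertexPoint-injective : Injective _≡_ _≡_ vertexPoint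
  vertexPoint-injective {w} {w′} eq with w Fin.≟ w′
  ... | yes w≡w′ = w≡w′
  ... | no w≢w′ with blocks-apart w≢w′
  ...   | inj₁ gap = ⊥-elim (Far-irrefl (subst (λ a → Far a (vertexPoint w′)) eq (centers-far gap)))
  ...   | inj₂ gap = ⊥-elim (Far-irrefl (subst (Far (vertexPoint w′)) eq (centers-far gap)))

  drawing : LatticeDrawing G
  drawing = record
    { f = toCube ∘ vertexPoint
    ; f-inj = vertexPoint-injective ∘ toCube-injective
    ; wire = wireAt
    ; between = λ e → pathWire-between (path-induced e)
    ; proper = wires-proper ends-not-adjacent separated
    }

  parity-vertexPoint : ∀ w → parity (toCube (vertexPoint w)) ≡ bit w
  parity-vertexPoint w = begin
    (16 * toℕ w + bit w + 4 + 2 + 2) % 2  ≡⟨ cong (_% 2) (regroup (toℕ w) (bit w)) ⟩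
    (bit w + (8 * toℕ w + 4) * 2) % 2     ≡⟨ [m+kn]%n≡m%n (bit w) (8 * toℕ w + 4) 2 ⟩
    bit w % 2                             ≡⟨ m<n⇒m%n≡m (s≤s (bit≤1 w)) ⟩
    bit w                                 ∎
    where
    open ≡-Reasoning
    regroup : ∀ k b → 16 * k + b + 4 + 2 + 2 ≡ b + (8 * k + 4) * 2
    regroup = solve-∀

  opposite-parity : (∀ u v → E G u v ≡ true → colour u ≢ colour v) →
    OppositeParity {G = G} drawing
  opposite-parity proper-colouring u v adj same-parity =
    proper-colouring u v adj
      (bit-injective (trans (sym (parity-vertexPoint u)) (trans same-parity (parity-vertexPoint v))))
    where
    bit-injective : bit u ≡ bit v → colour u ≡ colour v
    bit-injective eq with colour u | colour v
    ... | true  | true  = refl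
    ... | false | false = refl

lemma3p1 : (n : ℕ) (G : Graph n) → Connected G → MaxDegreeAtMost G 6 →
    LatticeDrawing G × (Bipartite G → Σ (LatticeDrawing G) OppositeParity)
lemma3p1 n G _ max-degree =
  Drawing.drawing G max-degree (λ _ → false) ,
  λ (colour , proper-colouring) →
    Drawing.drawing G max-degree colour ,
    Drawing.opposite-parity G max-degree colour proper-colouring
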